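{- Let $T:\{1,2,\dots\}\times\{0,1,2,\dots\}\to\mathbb{N}$ be defined by $T(1,c)=1$ for all $c\ge 0$, $T(n,0)=T(n,1)=1$ for all $n\ge 1$, and $T(n,c)=T(n-1,c)+(n-1)\,T(n-1,c-2)$ for all $n\ge 2$, $c\ge 2$. Then for every fixed $c\ge 0$, $T(n,c)=O(n^c)$ as $n\to\infty$. -}

module Defs where

open import Data.Nat using (ℕ; zero; suc; _+_; _*_)

-- T n c for n ≥ 1 as in the paper. The value at n = 0 is junk (outside
-- the paper's domain {1,2,...}) and is never used by the statement.
T : ℕ → ℕ → ℕ
T zero c = 1
T (suc zero) c = 1
T (suc (suc k)) zero = 1
T (suc (suc k)) (suc zero) = 1
T (suc (suc k)) (suc (suc c)) = T (suc k) (suc (suc c)) + suc k * T (suc k) c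

-- For n ≥ 1 one has T n c ≤ n ^ c, so C = N = 1 works. The induction step
-- rests on a ^ (c + 2) + a · a ^ c = (a + 1) · a ^ (c + 1) ≤ (a + 1) ^ (c + 2).
module Submission where

open import Defs
open import Data.Nat using (ℕ; zero; suc; _+_; _*_; _^_; _≤_; s≤s; z≤n)
open import Data.Nat.Properties
open import Data.Product using (∃-syntax; _×_; _,_)
open import Relation.Binary.PropositionalEquality using (sym)

^-step-≤ : ∀ a c → a ^ (2 + c) + a * a ^ c ≤ suc a ^ (2 + c)
^-step-≤ a c = begin
  a * a ^ suc c + a ^ suc c  ≡⟨ +-comm (a * a ^ suc c) (a ^ suc c) ⟩
  suc a * a ^ suc c          ≤⟨ *-monoʳ-≤ (suc a) (^-monoˡ-≤ (suc c) (n≤1+n a)) ⟩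
  suc a * suc a ^ suc c      ∎
  where open ≤-Reasoning

T-suc≤^ : ∀ n c → T (suc n) c ≤ suc n ^ c
T-suc≤^ zero          c             = ≤-reflexive (sym (^-zeroˡ c))
T-suc≤^ (suc n)       zero          = ≤-refl
T-suc≤^ (suc n)       (suc zero)    = s≤s z≤n
T-suc≤^ (suc n)       (suc (suc c)) = begin
  T (suc n) (2 + c) + suc n * T (suc n) c
    ≤⟨ +-mono-≤ (T-suc≤^ n (2 + c)) (*-monoʳ-≤ (suc n) (T-suc≤^ n c)) ⟩
  suc n ^ (2 + c) + suc n * suc n ^ c
    ≤⟨ ^-step-≤ (suc n) c ⟩
  suc (suc n) ^ (2 + c) ∎
  where open ≤-Reasoning

lemma3 : ∀ (c : ℕ) → ∃[ C ] ∃[ N ] (1 ≤ N × (∀ n → N ≤ n → T n c ≤ C * n ^ c))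
lemma3 c = 1 , 1 , ≤-refl , bound
  where
  bound : ∀ n → 1 ≤ n → T n c ≤ 1 * n ^ c
  bound (suc n) _ rewrite *-identityˡ (suc n ^ c) = T-suc≤^ n c
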